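{- For any integers $c\ge 2$ and $0\le t\le c-2$, $\chi(t,c)=\infty$, i.e., no finite number of colors suffices to $c$-strong color all $t$-intersecting hypergraphs.
   Context: A hypergraph $G$ consists of a finite vertex set together with a collection of subsets of it (edges). For an integer $c\ge 2$, a $c$-strong coloring of $G$ is an assignment of colors to its vertices such that every edge $e$ of $G$ contains vertices of at least $\min\{c,|e|\}$ distinct colors. $G$ is $t$-intersecting if every two edges of $G$ have at least $t$ vertices in common. For integers $c\ge 2$, $t\ge 0$, $\chi(t,c)$ denotes the minimum number of colors that suffices to $c$-strong color every $t$-intersecting hypergraph ($\infty$ if no finite number suffices). -}

module Defs where

open import Data.Nat using (ℕ; _≤_; _⊓_)
open import Data.Fin using (Fin)
open import Data.Fin.Subset using (Subset; _∈_; _∩_; ∣_∣)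
open import Data.List using (List)
import Data.List.Membership.Propositional as L
open import Data.Product using (Σ; _×_)
open import Function.Definitions using (Injective)
open import Relation.Binary.PropositionalEquality using (_≡_)

Hypergraph : ℕ → Set
Hypergraph n = List (Subset n)

Colouring : ℕ → ℕ → Set
Colouring n k = Fin n → Fin k

HasDistinctColours : ∀ {n k} → Colouring n k → Subset n → ℕ → Set
HasDistinctColours {n} col e m =
  Σ (Fin m → Fin n) λ f → ((i : Fin m) → f i ∈ e) × Injective _≡_ _≡_ (λ i → col (f i))

IsStrongColouring : ∀ {n k} → ℕ → Hypergraph n → Colouring n k → Set
IsStrongColouring c G col = ∀ e → e L.∈ G → HasDistinctColours col e (c ⊓ ∣ e ∣)

IsIntersecting : ∀ {n} → ℕ → Hypergraph n → Set
IsIntersecting t G = ∀ e e′ → e L.∈ G → e′ L.∈ G → t ≤ ∣ e ∩ e′ ∣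

-- Take k + 1 "private" vertices and t "core" vertices, and for every two private
-- vertices x, y the edge {x, y} ∪ core.  Every two edges share the core, so the
-- hypergraph is t-intersecting.  With k colours two private vertices x ≠ y get the
-- same colour, and then the edge {x, y} ∪ core, of size t + 2 ≤ c, shows at most
-- t + 1 colours although a c-strong colouring would need t + 2.
module Submission where

open import Defs
open import Data.Nat using (ℕ; _≤_; _+_)
open import Data.Product using (Σ; _×_)
open import Relation.Nullary using (¬_)

open import Data.Nat using (suc; _<_; z≤n; s≤s)
open import Data.Nat.Properties
  using (≤-trans; +-comm; +-monoʳ-≤; n≤1+n; +-suc; <-≤-trans; <-irrefl; n<1+n; m≤n+m; +-monoˡ-≤; m≥n⇒m⊓n≡n; module ≤-Reasoning)
open import Data.Fin using (Fin; _↑ˡ_)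
open import Data.Fin.Properties using (↑ˡ-injective; suc-injective; injective⇒≤; pigeonhole; <⇒≢)
open import Data.Fin.Subset using (Subset; inside; outside; ⊤; ⁅_⁆; _∪_; _∩_; _-_; _∈_; ∣_∣)
open import Data.Fin.Subset.Properties
  using (x∈⁅x⁆; p⊆p∪q; q⊆p∪q; x∈p∧x≢y⇒x∈p-y; x∈p⇒∣p-x∣<∣p∣; ∣⊤∣≡n; ∣⁅x⁆∣≡1; ∩-identityʳ)
open import Data.Vec using ([]; _∷_; _++_; here; there)
open import Data.Vec.Properties using (zipWith-++)
open import Data.Bool using (_∧_)
open import Data.List using (cartesianProductWith; allFin)
open import Data.List.Membership.Propositional.Properties
  using (∈-cartesianProductWith⁺; ∈-cartesianProductWith⁻; ∈-allFin)
open import Data.Product using (_,_)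
open import Function.Definitions using (Injective)
open import Relation.Nullary using (yes; no)
open import Relation.Binary.PropositionalEquality using (_≡_; _≢_; refl; sym; trans; cong; cong₂; subst)
open import Function using (_∘_)
import Data.Fin as Fin

private
  variable
    n m d : ℕ

rank : (p : Subset n) {x : Fin n} → x ∈ p → Fin ∣ p ∣
rank (inside ∷ p)  here        = Fin.zero
rank (inside ∷ p)  (there x∈p) = Fin.suc (rank p x∈p)
rank (outside ∷ p) (there x∈p) = rank p x∈p

rank-injective : (p : Subset n) {x y : Fin n} (x∈p : x ∈ p) (y∈p : y ∈ p) →
                 rank p x∈p ≡ rank p y∈p → x ≡ y
rank-injective (inside ∷ p)  here        here        _  = refl
rank-injective (inside ∷ p)  (there x∈p) (there y∈p) eq =
  cong Fin.suc (rank-injective p x∈p y∈p (suc-injective eq))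
rank-injective (outside ∷ p) (there x∈p) (there y∈p) eq =
  cong Fin.suc (rank-injective p x∈p y∈p eq)

injective-into⇒≤∣p∣ : (p : Subset n) (f : Fin d → Fin n) (f∈p : ∀ i → f i ∈ p) →
                      Injective _≡_ _≡_ f → d ≤ ∣ p ∣
injective-into⇒≤∣p∣ p f f∈p f-inj =
  injective⇒≤ (λ {i} {j} eq → f-inj (rank-injective p (f∈p i) (f∈p j) eq))

∣p∪q∣≤∣p∣+∣q∣ : (p q : Subset n) → ∣ p ∪ q ∣ ≤ ∣ p ∣ + ∣ q ∣
∣p∪q∣≤∣p∣+∣q∣ []            []            = z≤n
∣p∪q∣≤∣p∣+∣q∣ (inside ∷ p)  (inside ∷ q)  =
  s≤s (≤-trans (∣p∪q∣≤∣p∣+∣q∣ p q) (+-monoʳ-≤ ∣ p ∣ (n≤1+n ∣ q ∣)))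
∣p∪q∣≤∣p∣+∣q∣ (inside ∷ p)  (outside ∷ q) = s≤s (∣p∪q∣≤∣p∣+∣q∣ p q)
∣p∪q∣≤∣p∣+∣q∣ (outside ∷ p) (inside ∷ q)  =
  subst (∣ p ∪ q ∣ <_) (sym (+-suc ∣ p ∣ ∣ q ∣)) (s≤s (∣p∪q∣≤∣p∣+∣q∣ p q))
∣p∪q∣≤∣p∣+∣q∣ (outside ∷ p) (outside ∷ q) = ∣p∪q∣≤∣p∣+∣q∣ p q

∣p++q∣≡∣p∣+∣q∣ : (p : Subset n) (q : Subset m) → ∣ p ++ q ∣ ≡ ∣ p ∣ + ∣ q ∣
∣p++q∣≡∣p∣+∣q∣ []            q = refl
∣p++q∣≡∣p∣+∣q∣ (inside ∷ p)  q = cong suc (∣p++q∣≡∣p∣+∣q∣ p q)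
∣p++q∣≡∣p∣+∣q∣ (outside ∷ p) q = ∣p++q∣≡∣p∣+∣q∣ p q

x∈p⇒x↑ˡ∈p++q : {p : Subset n} {x : Fin n} (q : Subset m) → x ∈ p → x ↑ˡ m ∈ p ++ q
x∈p⇒x↑ˡ∈p++q q here        = here
x∈p⇒x↑ˡ∈p++q q (there x∈p) = there (x∈p⇒x↑ˡ∈p++q q x∈p)

module _ {k : ℕ} (col : Colouring n k) where

  distinctColours⇒≤∣e∣ : {e : Subset n} → HasDistinctColours col e d → d ≤ ∣ e ∣
  distinctColours⇒≤∣e∣ {e = e} (f , f∈e , col∘f-inj) =
    injective-into⇒≤∣p∣ e f f∈e (λ eq → col∘f-inj (cong col eq))

  -- Redirecting v to the equally coloured u keeps the chosen colours and avoids v.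
  identifyColours : {e : Subset n} {u v : Fin n} → u ∈ e → u ≢ v → col u ≡ col v →
                    HasDistinctColours col e d → HasDistinctColours col (e - v) d
  identifyColours {e = e} {u} {v} u∈e u≢v u~v (f , f∈e , col∘f-inj) =
    redirect ∘ f , redirect∈e-v ,
    λ eq → col∘f-inj (trans (sym (col∘redirect _)) (trans eq (col∘redirect _)))
    where
    redirect : Fin n → Fin n
    redirect w with w Fin.≟ v
    ... | yes _ = u
    ... | no  _ = w

    col∘redirect : ∀ w → col (redirect w) ≡ col w
    col∘redirect w with w Fin.≟ v
    ... | yes refl = u~v
    ... | no  _    = refl

    redirect∈e-v : ∀ i → redirect (f i) ∈ e - v
    redirect∈e-v i with f i Fin.≟ v
    ... | yes _    = x∈p∧x≢y⇒x∈p-y u∈e u≢v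
    ... | no  fi≢v = x∈p∧x≢y⇒x∈p-y (f∈e i) fi≢v

  monochromaticPair⇒<∣e∣ : {e : Subset n} {u v : Fin n} → u ∈ e → v ∈ e → u ≢ v →
                           col u ≡ col v → HasDistinctColours col e d → d < ∣ e ∣
  monochromaticPair⇒<∣e∣ u∈e v∈e u≢v u~v colours =
    <-≤-trans (s≤s (distinctColours⇒≤∣e∣ (identifyColours u∈e u≢v u~v colours)))
              (x∈p⇒∣p-x∣<∣p∣ v∈e)

module Construction (K m : ℕ) where

  core : Subset m
  core = ⊤

  edge : Fin K → Fin K → Subset (K + m)
  edge x y = (⁅ x ⁆ ∪ ⁅ y ⁆) ++ core

  hypergraph : Hypergraph (K + m)
  hypergraph = cartesianProductWith edge (allFin K) (allFin K)

  m≤∣edge∩edge∣ : ∀ x y x′ y′ → m ≤ ∣ edge x y ∩ edge x′ y′ ∣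
  m≤∣edge∩edge∣ x y x′ y′ = begin
    m                          ≡⟨ sym (∣⊤∣≡n m) ⟩
    ∣ core ∣                   ≡⟨ cong ∣_∣ (sym (∩-identityʳ core)) ⟩
    ∣ core ∩ core ∣            ≤⟨ m≤n+m _ ∣ pairs ∣ ⟩
    ∣ pairs ∣ + ∣ core ∩ core ∣ ≡⟨ sym (∣p++q∣≡∣p∣+∣q∣ pairs (core ∩ core)) ⟩
    ∣ pairs ++ (core ∩ core) ∣ ≡⟨ cong ∣_∣ (sym (zipWith-++ _∧_ (⁅ x ⁆ ∪ ⁅ y ⁆) core (⁅ x′ ⁆ ∪ ⁅ y′ ⁆) core)) ⟩
    ∣ edge x y ∩ edge x′ y′ ∣  ∎
    where
    open ≤-Reasoning
    pairs : Subset K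
    pairs = (⁅ x ⁆ ∪ ⁅ y ⁆) ∩ (⁅ x′ ⁆ ∪ ⁅ y′ ⁆)

  hypergraph-intersecting : IsIntersecting m hypergraph
  hypergraph-intersecting e e′ e∈G e′∈G
    with x , y , _ , _ , refl ← ∈-cartesianProductWith⁻ edge (allFin K) (allFin K) e∈G
       | x′ , y′ , _ , _ , refl ← ∈-cartesianProductWith⁻ edge (allFin K) (allFin K) e′∈G
    = m≤∣edge∩edge∣ x y x′ y′

  ∣edge∣≤2+m : ∀ x y → ∣ edge x y ∣ ≤ 2 + m
  ∣edge∣≤2+m x y = begin
    ∣ edge x y ∣                     ≡⟨ ∣p++q∣≡∣p∣+∣q∣ (⁅ x ⁆ ∪ ⁅ y ⁆) core ⟩
    ∣ ⁅ x ⁆ ∪ ⁅ y ⁆ ∣ + ∣ core ∣     ≤⟨ +-monoˡ-≤ ∣ core ∣ (∣p∪q∣≤∣p∣+∣q∣ ⁅ x ⁆ ⁅ y ⁆) ⟩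
    ∣ ⁅ x ⁆ ∣ + ∣ ⁅ y ⁆ ∣ + ∣ core ∣ ≡⟨ cong₂ (λ a b → a + b + ∣ core ∣) (∣⁅x⁆∣≡1 x) (∣⁅x⁆∣≡1 y) ⟩
    2 + ∣ core ∣                     ≡⟨ cong (2 +_) (∣⊤∣≡n m) ⟩
    2 + m                            ∎
    where open ≤-Reasoning

  noStrongColouring : ∀ {c k} → 2 + m ≤ c → k < K →
                      ¬ (Σ (Colouring (K + m) k) λ col → IsStrongColouring c hypergraph col)
  noStrongColouring 2+m≤c k<K (col , strong)
    with x , y , x<y , x~y ← pigeonhole k<K (λ z → col (z ↑ˡ m)) =
    <-irrefl refl (monochromaticPair⇒<∣e∣ col x∈e y∈e (<⇒≢ x<y ∘ ↑ˡ-injective m x y) x~y colours)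
    where
    e : Subset (K + m)
    e = edge x y
    x∈e : x ↑ˡ m ∈ e
    x∈e = x∈p⇒x↑ˡ∈p++q core (p⊆p∪q ⁅ y ⁆ (x∈⁅x⁆ x))
    y∈e : y ↑ˡ m ∈ e
    y∈e = x∈p⇒x↑ˡ∈p++q core (q⊆p∪q ⁅ x ⁆ ⁅ y ⁆ (x∈⁅x⁆ y))
    colours : HasDistinctColours col e ∣ e ∣
    colours = subst (HasDistinctColours col e)
                    (m≥n⇒m⊓n≡n (≤-trans (∣edge∣≤2+m x y) 2+m≤c))
                    (strong e (∈-cartesianProductWith⁺ edge (∈-allFin x) (∈-allFin y)))

mainTheorem3 : (c t : ℕ) → 2 ≤ c → t + 2 ≤ c → (k : ℕ) →
    Σ ℕ λ n → Σ (Hypergraph n) λ G →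
    IsIntersecting t G × ¬ (Σ (Colouring n k) λ col → IsStrongColouring c G col)
mainTheorem3 c t _ t+2≤c k =
  suc k + t , hypergraph , hypergraph-intersecting ,
  noStrongColouring (subst (_≤ c) (+-comm t 2) t+2≤c) (n<1+n k)
  where open Construction (suc k) t
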